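{- Let $f$ be a Boolean function every minterm of which has at most two literals (equivalently, $f$ admits a DNF all of whose terms contain at most two literals). Then $\gamma(f) \geq l(f)/3$, where $l(f)$ is the size of a largest maxterm of $f$.
   Context: Let $f$ be a Boolean function on variables $V=\{x_1,\dots,x_n\}$. A literal is a variable $x$ or its negation $\overline{x}$, with $\overline{x}(\sigma)=1-x(\sigma)$. A minterm (maxterm) of $f$ is a minimal set of literals such that setting all its literals to $1$ (resp. $0$) forces $f$ to evaluate to $1$ (resp. $0$) regardless of the other variables. Each variable $x$ has a cost $c(x)\ge 0$ paid to read its value; $c(U)=\sum_{x\in U}c(x)$. An assignment $\sigma$ gives each variable a value in $\{0,1\}$; $\sigma_U$ is its restriction to $U\subseteq V$. A set $U$ is a proof of $f$ for $\sigma$ if the value of $f$ is determined by $\sigma_U$ and this holds for no proper subset of $U$. An evaluation algorithm $\mathbb{A}$ is a deterministic decision tree that adaptively reads variables until the set of variables read contains a proof for the current assignment. $c^f_{\mathbb{A}}(\sigma)$ is the total cost of the variables read by $\mathbb{A}$ on $\sigma$, and $c^f(\sigma)$ is the minimum cost of a proof of $f$ for $\sigma$. $\gamma^{\mathbb{A}}_c(f)$ is the infimum of all $\rho$ with $c^f_{\mathbb{A}}(\sigma)\le \rho\, c^f(\sigma)$ for every assignment $\sigma$; $\gamma^{\mathbb{A}}(f)=\sup_c \gamma^{\mathbb{A}}_c(f)$ over all nonnegative cost functions $c$; and $\gamma(f)=\inf_{\mathbb{A}}\gamma^{\mathbb{A}}(f)$ over all deterministic evaluation algorithms. -}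

module Defs where

open import Data.Nat using (ℕ; zero; suc; _+_; _*_; _<_; _≤_)
open import Data.Fin using (Fin)
open import Data.Bool using (Bool; true; false)
open import Data.Maybe using (Maybe; just; nothing)
open import Data.Product using (Σ; _×_; _,_)
open import Relation.Binary.PropositionalEquality using (_≡_)
open import Relation.Nullary using (¬_; yes; no)
open import Data.Fin using () renaming (_≟_ to _≟F_)

Assignment : ℕ → Set
Assignment n = Fin n → Bool

BoolFun : ℕ → Set
BoolFun n = Assignment n → Bool

-- A (consistent) set of literals on n variables: for each variable i,
-- nothing = variable absent, just true = literal x_i, just false = literal ¬x_i.
LitSet : ℕ → Set
LitSet n = Fin n → Maybe Bool

_⊆L_ : {n : ℕ} → LitSet n → LitSet n → Set
_⊆L_ {n} s t = (i : Fin n) (b : Bool) → s i ≡ just b → t i ≡ just b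

sizeL : {n : ℕ} → LitSet n → ℕ
sizeL {zero} t = 0
sizeL {suc n} t with t Fin.zero
... | nothing = sizeL {n} (λ i → t (Fin.suc i))
... | just _  = suc (sizeL {n} (λ i → t (Fin.suc i)))

AllOne : {n : ℕ} → LitSet n → Assignment n → Set
AllOne {n} t σ = (i : Fin n) (b : Bool) → t i ≡ just b → σ i ≡ b

AllZero : {n : ℕ} → LitSet n → Assignment n → Set
AllZero {n} t σ = (i : Fin n) (b : Bool) → t i ≡ just b → ¬ (σ i ≡ b)

Forces1 : {n : ℕ} → BoolFun n → LitSet n → Set
Forces1 {n} f t = (σ : Assignment n) → AllOne t σ → f σ ≡ true

Forces0 : {n : ℕ} → BoolFun n → LitSet n → Set
Forces0 {n} f t = (σ : Assignment n) → AllZero t σ → f σ ≡ false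

IsMinterm : {n : ℕ} → BoolFun n → LitSet n → Set
IsMinterm {n} f t = Forces1 f t × ((s : LitSet n) → s ⊆L t → Forces1 f s → t ⊆L s)

IsMaxterm : {n : ℕ} → BoolFun n → LitSet n → Set
IsMaxterm {n} f t = Forces0 f t × ((s : LitSet n) → s ⊆L t → Forces0 f s → t ⊆L s)

VarSet : ℕ → Set
VarSet n = Fin n → Bool

_⊆V_ : {n : ℕ} → VarSet n → VarSet n → Set
_⊆V_ {n} U W = (i : Fin n) → U i ≡ true → W i ≡ true

AgreeOn : {n : ℕ} → VarSet n → Assignment n → Assignment n → Set
AgreeOn {n} U σ τ = (i : Fin n) → U i ≡ true → σ i ≡ τ i

Determines : {n : ℕ} → BoolFun n → Assignment n → VarSet n → Set
Determines {n} f σ U = (τ : Assignment n) → AgreeOn U σ τ → f τ ≡ f σ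

IsProof : {n : ℕ} → BoolFun n → Assignment n → VarSet n → Set
IsProof {n} f σ U = Determines f σ U × ((W : VarSet n) → W ⊆V U → Determines f σ W → U ⊆V W)

Cost : ℕ → Set
Cost n = Fin n → ℕ

costOf : {n : ℕ} → Cost n → VarSet n → ℕ
costOf {zero} c U = 0
costOf {suc n} c U with U Fin.zero
... | true  = c Fin.zero + costOf {n} (λ i → c (Fin.suc i)) (λ i → U (Fin.suc i))
... | false = costOf {n} (λ i → c (Fin.suc i)) (λ i → U (Fin.suc i))

-- deterministic decision trees: node i t₀ t₁ reads x_i and continues
-- with t₀ if x_i = 0 and with t₁ if x_i = 1; leaf stops.
data DTree (n : ℕ) : Set where
  leaf : DTree n
  node : Fin n → DTree n → DTree n → DTree n

emptyV : {n : ℕ} → VarSet n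
emptyV _ = false

addV : {n : ℕ} → Fin n → VarSet n → VarSet n
addV i U j with i ≟F j
... | yes _ = true
... | no _  = U j

readFrom : {n : ℕ} → DTree n → Assignment n → VarSet n → VarSet n
readFrom leaf σ U = U
readFrom (node i t₀ t₁) σ U with σ i
... | false = readFrom t₀ σ (addV i U)
... | true  = readFrom t₁ σ (addV i U)

readSet : {n : ℕ} → DTree n → Assignment n → VarSet n
readSet A σ = readFrom A σ emptyV

IsEvaluation : {n : ℕ} → BoolFun n → DTree n → Set
IsEvaluation {n} f A = (σ : Assignment n) → Σ (VarSet n) λ P → P ⊆V readSet A σ × IsProof f σ P

algCost : {n : ℕ} → DTree n → Cost n → Assignment n → ℕ
algCost A c σ = costOf c (readSet A σ)

-- RatioExceeds f A r s : there is a cost c and an assignment σ with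
-- c^f_A(σ) > (r/s) · c^f(σ), witnessed by a proof U of f for σ with
-- s · c^f_A(σ) > r · c(U).  γ^A(f) ≥ L holds iff RatioExceeds f A r s
-- for every rational r/s < L.
RatioExceeds : {n : ℕ} → BoolFun n → DTree n → ℕ → ℕ → Set
RatioExceeds {n} f A r s =
  Σ (Cost n) λ c → Σ (Assignment n) λ σ → Σ (VarSet n) λ U →
    IsProof f σ U × (r * costOf c U < s * algCost A c σ)

-- Let M be a maxterm, X its set of variables and τ the assignment making every
-- literal of M false; by minimality of M, X is a proof of f = 0 for τ.
-- If the algorithm reads a variable outside X on τ, make exactly those variables
-- cost 1: the proof X is free while the algorithm pays.  Otherwise it reads
-- exactly X on τ.  An adversary then answers as τ until the last variable x of X
-- is queried, and from there on follows an assignment ρ that agrees with τ on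
-- X ∖ {x} but has f ρ = 1 (it exists because X ∖ {x} is not a proof for τ).  On ρ
-- the algorithm has read all |M| variables of X, whereas a proof for ρ is a
-- minterm and so has at most 2 variables: with unit costs the ratio is at least
-- |M|/2 > |M|/3.

module Submission where

open import Defs
open import Data.Nat using (ℕ; zero; suc; _+_; _*_; _<_; _≤_; z≤n)
open import Data.Nat.Properties
  using (+-monoʳ-≤; ≤-trans; m≤n+m; m≤m+n; ≤-antisym; *-monoʳ-≤; *-monoˡ-≤; *-comm; *-zeroʳ; n≮0; m≤n*m; n≤1+n; n<1+n; <-≤-trans; module ≤-Reasoning)
open import Data.Bool using (Bool; true; false; not; if_then_else_; _≟_)
open import Data.Bool.Properties using (¬-not; not-¬)
open import Data.Maybe using (just; nothing; is-just; maybe′)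
open import Data.Maybe.Properties using (just-injective)
open import Data.Fin using (Fin) renaming (zero to fzero; suc to fsuc; _≟_ to _≟ᶠ_)
open import Data.Fin.Properties using (all?; ¬∀⟶∃¬)
open import Data.Fin.Subset.Properties using (anySubset?)
open import Data.Vec using (lookup; tabulate)
open import Data.Vec.Properties using (lookup∘tabulate)
open import Data.Product using (∃; _×_; _,_; proj₁; proj₂)
open import Data.Empty using (⊥-elim)
open import Function using (_∘_; case_of_)
open import Relation.Nullary using (¬_; Dec; yes; no)
open import Relation.Nullary.Decidable using (_×-dec_; _→-dec_; ¬?; decidable-stable; map′)
open import Relation.Unary using (Decidable)
open import Relation.Binary.PropositionalEquality

private
  variable
    n : ℕ

⊆V? : (X U : VarSet n) → Dec (X ⊆V U)
⊆V? X U = all? λ i → X i ≟ true →-dec U i ≟ true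

⊈V⇒witness : {X U : VarSet n} → ¬ (X ⊆V U) → ∃ λ i → X i ≡ true × U i ≡ false
⊈V⇒witness {n} {X} {U} X⊈U =
  let i , ¬[Xi⇒Ui] = ¬∀⟶∃¬ n _ (λ i → X i ≟ true →-dec U i ≟ true) X⊈U
  in i , witness (X i) (U i) ¬[Xi⇒Ui]
  where
  witness : ∀ x u → ¬ (x ≡ true → u ≡ true) → x ≡ true × u ≡ false
  witness true  false _ = refl , refl
  witness true  true  h = ⊥-elim (h λ _ → refl)
  witness false _     h = ⊥-elim (h λ ())

AgreeOn? : (W : VarSet n) (σ τ : Assignment n) → Dec (AgreeOn W σ τ)
AgreeOn? W σ τ = all? λ i → W i ≟ true →-dec σ i ≟ τ i

Extensional : BoolFun n → Set
Extensional f = ∀ {σ τ} → (∀ i → σ i ≡ τ i) → f σ ≡ f τ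

anyAssignment? : {Q : Assignment n → Set} →
  (∀ {σ τ} → (∀ i → σ i ≡ τ i) → Q σ → Q τ) → Decidable Q → Dec (∃ Q)
anyAssignment? resp Q? = map′
  (λ (v , q) → lookup v , q)
  (λ (σ , q) → tabulate σ , resp (sym ∘ lookup∘tabulate σ) q)
  (anySubset? (Q? ∘ lookup))

costOf-mono : (c : Cost n) {U V : VarSet n} → U ⊆V V → costOf c U ≤ costOf c V
costOf-mono {zero}  c U⊆V = z≤n
costOf-mono {suc n} c {U} {V} U⊆V with U fzero in U0 | V fzero in V0
... | true  | true  = +-monoʳ-≤ (c fzero) (costOf-mono (c ∘ fsuc) (U⊆V ∘ fsuc))
... | true  | false = case trans (sym (U⊆V fzero U0)) V0 of λ ()
... | false | true  = ≤-trans (costOf-mono (c ∘ fsuc) (U⊆V ∘ fsuc)) (m≤n+m _ (c fzero))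
... | false | false = costOf-mono (c ∘ fsuc) (U⊆V ∘ fsuc)

costOf-∋ : (c : Cost n) {U : VarSet n} {i : Fin n} → U i ≡ true → c i ≤ costOf c U
costOf-∋ c {U} {fzero} U0 with U fzero
... | true = m≤m+n (c fzero) _
costOf-∋ c {U} {fsuc i} Ui with U fzero
... | true  = ≤-trans (costOf-∋ (c ∘ fsuc) Ui) (m≤n+m _ (c fzero))
... | false = costOf-∋ (c ∘ fsuc) Ui

costOf-zero : (c : Cost n) {U : VarSet n} → (∀ i → U i ≡ true → c i ≡ 0) → costOf c U ≡ 0
costOf-zero {zero}  c c≡0 = refl
costOf-zero {suc n} c {U} c≡0 with U fzero in U0
... | true  = cong₂ _+_ (c≡0 fzero U0) (costOf-zero (c ∘ fsuc) (c≡0 ∘ fsuc))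
... | false = costOf-zero (c ∘ fsuc) (c≡0 ∘ fsuc)

costOf-cong : (c : Cost n) {U V : VarSet n} → (∀ i → U i ≡ V i) → costOf c U ≡ costOf c V
costOf-cong c U≗V = ≤-antisym
  (costOf-mono c λ i Ui → trans (sym (U≗V i)) Ui)
  (costOf-mono c λ i Vi → trans (U≗V i) Vi)

unitCost : Cost n
unitCost _ = 1

⊆∅⇒costOf≡0 : (c : Cost n) {U : VarSet n} → U ⊆V emptyV → costOf c U ≡ 0
⊆∅⇒costOf≡0 c U⊆∅ = costOf-zero c λ i Ui → case U⊆∅ i Ui of λ ()

support : LitSet n → VarSet n
support t i = is-just (t i)

support⇒just : (t : LitSet n) {i : Fin n} → support t i ≡ true → ∃ λ b → t i ≡ just b
support⇒just t {i} ti with t i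
... | just b = b , refl

sizeL≡costOf-support : (t : LitSet n) → sizeL t ≡ costOf unitCost (support t)
sizeL≡costOf-support {zero}  t = refl
sizeL≡costOf-support {suc n} t with t fzero
... | nothing = sizeL≡costOf-support (t ∘ fsuc)
... | just _  = cong suc (sizeL≡costOf-support (t ∘ fsuc))

support-mono : {s t : LitSet n} → s ⊆L t → support s ⊆V support t
support-mono {s = s} s⊆t i si = let b , si≡ = support⇒just s si in cong is-just (s⊆t i b si≡)

⊆L-agree : {s t : LitSet n} {i : Fin n} → s ⊆L t → support s i ≡ true → s i ≡ t i
⊆L-agree {s = s} s⊆t si = let b , si≡ = support⇒just s si in trans si≡ (sym (s⊆t _ b si≡))

AllOne-⊆ : {s t : LitSet n} {σ : Assignment n} → s ⊆L t → AllOne t σ → AllOne s σ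
AllOne-⊆ s⊆t ones i b si = ones i b (s⊆t i b si)

AllOne-agree : {t : LitSet n} {ρ τ : Assignment n} → AllOne t ρ → AgreeOn (support t) ρ τ → AllOne t τ
AllOne-agree ones agree i b ti = trans (sym (agree i (cong is-just ti))) (ones i b ti)

_↾_ : LitSet n → VarSet n → LitSet n
(t ↾ W) i = if W i then t i else nothing

↾-just : (t : LitSet n) (W : VarSet n) {i : Fin n} {b : Bool} →
  (t ↾ W) i ≡ just b → W i ≡ true × t i ≡ just b
↾-just t W {i} ti with W i
... | true = refl , ti

↾-∋ : (t : LitSet n) (W : VarSet n) {i : Fin n} → W i ≡ true → (t ↾ W) i ≡ t i
↾-∋ t W Wi rewrite Wi = refl

literals : Assignment n → LitSet n
literals σ i = just (σ i)

support-literals↾ : (σ : Assignment n) (P : VarSet n) (i : Fin n) → support (literals σ ↾ P) i ≡ P i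
support-literals↾ σ P i with P i
... | true  = refl
... | false = refl

AllOne-literals↾ : (ρ : Assignment n) (P : VarSet n) → AllOne (literals ρ ↾ P) ρ
AllOne-literals↾ ρ P i b ρPi = just-injective (proj₂ (↾-just (literals ρ) P ρPi))

sizeL-literals↾ : (ρ : Assignment n) (P : VarSet n) → sizeL (literals ρ ↾ P) ≡ costOf unitCost P
sizeL-literals↾ ρ P = trans (sizeL≡costOf-support (literals ρ ↾ P)) (costOf-cong unitCost (support-literals↾ ρ P))

addV-∋ : (i : Fin n) (U : VarSet n) → addV i U i ≡ true
addV-∋ i U with i ≟ᶠ i
... | yes _   = refl
... | no i≢i = ⊥-elim (i≢i refl)

addV-⊇ : (i : Fin n) (U : VarSet n) → U ⊆V addV i U
addV-⊇ i U j Uj with i ≟ᶠ j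
... | yes _ = refl
... | no _  = Uj

addV-⊆ : (i : Fin n) {U : VarSet n} → U i ≡ true → addV i U ⊆V U
addV-⊆ i Ui j _ with i ≟ᶠ j
addV-⊆ i Ui j _  | yes refl = Ui
addV-⊆ i Ui j Uj | no _     = Uj

removeV : Fin n → VarSet n → VarSet n
removeV i U j with i ≟ᶠ j
... | yes _ = false
... | no _  = U j

removeV-∌ : (i : Fin n) (U : VarSet n) → removeV i U i ≡ false
removeV-∌ i U with i ≟ᶠ i
... | yes _   = refl
... | no i≢i = ⊥-elim (i≢i refl)

removeV-⊆ : (i : Fin n) (U : VarSet n) → removeV i U ⊆V U
removeV-⊆ i U j Rj with i ≟ᶠ j
... | no _ = Rj

⊆removeV : (i : Fin n) {U X : VarSet n} → U ⊆V X → U i ≡ false → U ⊆V removeV i X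
⊆removeV i {U} U⊆X Ui j Uj with i ≟ᶠ j
... | yes refl = case trans (sym Uj) Ui of λ ()
... | no _     = U⊆X j Uj

readFrom-⊇ : (t : DTree n) (σ : Assignment n) (U : VarSet n) → U ⊆V readFrom t σ U
readFrom-⊇ leaf           σ U = λ _ Uj → Uj
readFrom-⊇ (node i t₀ t₁) σ U j Uj with σ i
... | false = readFrom-⊇ t₀ σ (addV i U) j (addV-⊇ i U j Uj)
... | true  = readFrom-⊇ t₁ σ (addV i U) j (addV-⊇ i U j Uj)

readFrom-node : (i : Fin n) (t₀ t₁ : DTree n) (σ : Assignment n) (U : VarSet n) {b : Bool} →
  σ i ≡ b → readFrom (node i t₀ t₁) σ U ≡ readFrom (if b then t₁ else t₀) σ (addV i U)
readFrom-node i t₀ t₁ σ U σi≡b with σ i | σi≡b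
... | false | refl = refl
... | true  | refl = refl

addV⊆readFrom-node : (i : Fin n) (t₀ t₁ : DTree n) (σ : Assignment n) (U : VarSet n) →
  addV i U ⊆V readFrom (node i t₀ t₁) σ U
addV⊆readFrom-node i t₀ t₁ σ U j rewrite readFrom-node i t₀ t₁ σ U refl =
  readFrom-⊇ (if σ i then t₁ else t₀) σ (addV i U) j

evaluation⇒extensional : {f : BoolFun n} {A : DTree n} → IsEvaluation f A → Extensional f
evaluation⇒extensional evA {σ} {τ} σ≗τ =
  let _ , _ , determines , _ = evA σ in sym (determines τ λ i _ → σ≗τ i)

¬Determines⇒counterexample : {f : BoolFun n} {σ : Assignment n} {W : VarSet n} →
  Extensional f → ¬ Determines f σ W → ∃ λ ρ → AgreeOn W σ ρ × f ρ ≢ f σ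
¬Determines⇒counterexample {f = f} {σ} {W} ext ¬det =
  decidable-stable (anyAssignment? respects λ ρ → AgreeOn? W σ ρ ×-dec ¬? (f ρ ≟ f σ)) λ none →
    ¬det λ τ agree → decidable-stable (f τ ≟ f σ) λ fτ≢fσ → none (τ , agree , fτ≢fσ)
  where
  respects : ∀ {ρ τ} → (∀ i → ρ i ≡ τ i) → AgreeOn W σ ρ × f ρ ≢ f σ → AgreeOn W σ τ × f τ ≢ f σ
  respects ρ≗τ (agree , fρ≢fσ) = (λ i Wi → trans (agree i Wi) (ρ≗τ i)) , fρ≢fσ ∘ trans (ext ρ≗τ)

proof-removeV-¬Determines : {f : BoolFun n} {σ : Assignment n} {X : VarSet n} {i : Fin n} →
  IsProof f σ X → X i ≡ true → ¬ Determines f σ (removeV i X)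
proof-removeV-¬Determines {i = i} (_ , minimal) Xi det =
  case trans (sym (minimal _ (removeV-⊆ i _) det i Xi)) (removeV-∌ i _) of λ ()

proof-flip : {f : BoolFun n} {σ : Assignment n} {X : VarSet n} {i : Fin n} →
  Extensional f → IsProof f σ X → X i ≡ true →
  ∃ λ ρ → AgreeOn (removeV i X) σ ρ × f ρ ≢ f σ
proof-flip ext proofX Xi = ¬Determines⇒counterexample ext (proof-removeV-¬Determines proofX Xi)

proof⊆readSet : {f : BoolFun n} {A : DTree n} {σ : Assignment n} {X : VarSet n} →
  IsEvaluation f A → IsProof f σ X → readSet A σ ⊆V X → X ⊆V readSet A σ
proof⊆readSet {σ = σ} evA (_ , minimal) read⊆X =
  let P , P⊆read , determines , _ = evA σ
  in λ i Xi → P⊆read i (minimal P (λ j Pj → read⊆X j (P⊆read j Pj)) determines i Xi)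

proof⇒minterm : {f : BoolFun n} {ρ : Assignment n} {P : VarSet n} →
  f ρ ≡ true → IsProof f ρ P → IsMinterm f (literals ρ ↾ P)
proof⇒minterm {n} {f} {ρ} {P} fρ (determines , minimal) = forces , minimality
  where
  forces : Forces1 f (literals ρ ↾ P)
  forces σ ones = trans (determines σ λ i Pi → sym (ones i (ρ i) (↾-∋ (literals ρ) P Pi))) fρ
  minimality : (s : LitSet n) → s ⊆L (literals ρ ↾ P) → Forces1 f s → (literals ρ ↾ P) ⊆L s
  minimality s s⊆ s-forces i b ρPi = trans (⊆L-agree s⊆ (P⊆s i Pi)) ρPi
    where
    Pi = proj₁ (↾-just (literals ρ) P ρPi)
    s⊆P : support s ⊆V P
    s⊆P k sk = trans (sym (support-literals↾ ρ P k)) (support-mono s⊆ k sk)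
    P⊆s : P ⊆V support s
    P⊆s = minimal (support s) s⊆P λ τ agree →
      trans (s-forces τ (AllOne-agree (AllOne-⊆ s⊆ (AllOne-literals↾ ρ P)) agree)) (sym fρ)

falsifier : LitSet n → Assignment n
falsifier t i = maybe′ not false (t i)

agree-falsifier⇒AllZero : (t : LitSet n) {τ : Assignment n} →
  AgreeOn (support t) (falsifier t) τ → AllZero t τ
agree-falsifier⇒AllZero t agree i b ti τi≡b =
  not-¬ τi≡b (trans (sym (agree i (cong is-just ti))) (cong (maybe′ not false) ti))

maxterm-falsifier : {f : BoolFun n} {M : LitSet n} → IsMaxterm f M → f (falsifier M) ≡ false
maxterm-falsifier {M = M} (forces , _) = forces (falsifier M) (agree-falsifier⇒AllZero M λ _ _ → refl)

maxterm⇒support-isProof : {f : BoolFun n} {M : LitSet n} →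
  IsMaxterm f M → IsProof f (falsifier M) (support M)
maxterm⇒support-isProof {n} {f} {M} (forces , maximal) = determines , minimality
  where
  f-falsifier = maxterm-falsifier (forces , maximal)
  determines : Determines f (falsifier M) (support M)
  determines τ agree = trans (forces τ (agree-falsifier⇒AllZero M agree)) (sym f-falsifier)
  minimality : (W : VarSet n) → W ⊆V support M → Determines f (falsifier M) W → support M ⊆V W
  minimality W W⊆M W-determines i Mi =
    let b , Mi≡ = support⇒just M Mi in proj₁ (↾-just M W (M⊆M↾W i b Mi≡))
    where
    M↾W-forces : Forces0 f (M ↾ W)
    M↾W-forces τ zeros = trans (W-determines τ agree) f-falsifier
      where
      agree : AgreeOn W (falsifier M) τ
      agree k Wk = let b , Mk = support⇒just M (W⊆M k Wk) in
        trans (cong (maybe′ not false) Mk) (sym (¬-not (zeros k b (trans (↾-∋ M W Wk) Mk))))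
    M⊆M↾W : M ⊆L (M ↾ W)
    M⊆M↾W = maximal (M ↾ W) (λ k b M↾Wk → proj₂ (↾-just M W M↾Wk)) M↾W-forces

module _ {f : BoolFun n} {σ : Assignment n} {X : VarSet n} (ext : Extensional f) (proofX : IsProof f σ X) where

  -- U is what has been read before reaching t; while X ⊈ U the answer for the
  -- last variable of X is still free to choose.
  Adversary : DTree n → VarSet n → Set
  Adversary t U = readFrom t σ U ⊆V X → X ⊆V readFrom t σ U → ¬ (X ⊆V U) →
    ∃ λ ρ → AgreeOn U σ ρ × f ρ ≢ f σ × X ⊆V readFrom t ρ U

  adversary : (t : DTree n) (U : VarSet n) → Adversary t U
  adversary leaf U _ X⊆U X⊈U = ⊥-elim (X⊈U X⊆U)
  adversary (node i t₀ t₁) U read⊆X X⊆read X⊈U with ⊆V? X (addV i U)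
  ... | yes X⊆U+i =
    let ρ , agree , fρ≢fσ = proof-flip ext proofX Xi
    in ρ , (λ k Uk → agree k (U⊆X-i k Uk)) , fρ≢fσ ,
       λ k Xk → addV⊆readFrom-node i t₀ t₁ ρ U k (X⊆U+i k Xk)
    where
    Xi : X i ≡ true
    Xi = read⊆X i (addV⊆readFrom-node i t₀ t₁ σ U i (addV-∋ i U))
    Ui : U i ≡ false
    Ui = ¬-not λ Ui → X⊈U λ k Xk → addV-⊆ i Ui k (X⊆U+i k Xk)
    U⊆X-i : U ⊆V removeV i X
    U⊆X-i = ⊆removeV i (λ k Uk → read⊆X k (readFrom-⊇ (node i t₀ t₁) σ U k Uk)) Ui
  ... | no X⊈U+i =
    let ρ , agree , fρ≢fσ , X⊆readρ = child (σ i)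
          (subst (_⊆V X) (readFrom-node i t₀ t₁ σ U refl) read⊆X)
          (subst (X ⊆V_) (readFrom-node i t₀ t₁ σ U refl) X⊆read)
          X⊈U+i
    in ρ , (λ k Uk → agree k (addV-⊇ i U k Uk)) , fρ≢fσ ,
       subst (X ⊆V_) (sym (readFrom-node i t₀ t₁ ρ U (sym (agree i (addV-∋ i U))))) X⊆readρ
    where
    child : (b : Bool) → Adversary (if b then t₁ else t₀) (addV i U)
    child false = adversary t₀ (addV i U)
    child true  = adversary t₁ (addV i U)

  adversary-readSet : {A : DTree n} → IsEvaluation f A → readSet A σ ⊆V X → ¬ (X ⊆V emptyV) →
    ∃ λ ρ → f ρ ≡ not (f σ) × X ⊆V readSet A ρ
  adversary-readSet {A} evA read⊆X X≢∅ =
    let ρ , _ , fρ≢fσ , X⊆read = adversary A emptyV read⊆X (proof⊆readSet {A = A} evA proofX read⊆X) X≢∅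
    in ρ , ¬-not fρ≢fσ , X⊆read

reads-outside-proof⇒RatioExceeds : {f : BoolFun n} {A : DTree n} {σ : Assignment n} {P : VarSet n} {i : Fin n}
  (r s : ℕ) → IsProof f σ P → readSet A σ i ≡ true → P i ≡ false → RatioExceeds f A r (suc s)
reads-outside-proof⇒RatioExceeds {n} {A = A} {σ} {P} {i} r s proofP read∋i Pi = c , σ , P , proofP , ratio
  where
  c : Cost n
  c k = if P k then 0 else 1
  ratio : r * costOf c P < suc s * algCost A c σ
  ratio = begin-strict
    r * costOf c P         ≡⟨ cong (r *_) (costOf-zero c λ k Pk → cong (if_then 0 else 1) Pk) ⟩
    r * 0                  ≡⟨ *-zeroʳ r ⟩
    0                      <⟨ n<1+n 0 ⟩
    1                      ≡⟨ cong (if_then 0 else 1) (sym Pi) ⟩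
    c i                    ≤⟨ costOf-∋ c read∋i ⟩
    algCost A c σ          ≤⟨ m≤n*m _ (suc s) ⟩
    suc s * algCost A c σ  ∎
    where open ≤-Reasoning

unitCost⇒RatioExceeds : {f : BoolFun n} {A : DTree n} {ρ : Assignment n} {P X : VarSet n} {r s : ℕ} →
  IsProof f ρ P → X ⊆V readSet A ρ → r * costOf unitCost P < s * costOf unitCost X →
  RatioExceeds f A r s
unitCost⇒RatioExceeds {s = s} proofP X⊆read ratio =
  unitCost , _ , _ , proofP , <-≤-trans ratio (*-monoʳ-≤ s (costOf-mono unitCost X⊆read))

3r<ls∧p≤2⇒rp<sl : (r l : ℕ) {s p : ℕ} → 3 * r < l * s → p ≤ 2 → r * p < s * l
3r<ls∧p≤2⇒rp<sl r l {s} {p} 3r<ls p≤2 = begin-strict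
  r * p  ≤⟨ *-monoʳ-≤ r p≤2 ⟩
  r * 2  ≡⟨ *-comm r 2 ⟩
  2 * r  ≤⟨ *-monoˡ-≤ r (n≤1+n 2) ⟩
  3 * r  <⟨ 3r<ls ⟩
  l * s  ≡⟨ *-comm l s ⟩
  s * l  ∎
  where open ≤-Reasoning

theorem1 : (n : ℕ) (f : BoolFun n) →
    ((t : LitSet n) → IsMinterm f t → sizeL t ≤ 2) →
    (M : LitSet n) → IsMaxterm f M →
    (A : DTree n) → IsEvaluation f A →
    (r s : ℕ) → 3 * r < sizeL M * s →
    RatioExceeds f A r s
theorem1 n f minterm≤2 M maxM A evA r zero 3r<0 =
  ⊥-elim (n≮0 (subst (3 * r <_) (*-zeroʳ (sizeL M)) 3r<0))
theorem1 n f minterm≤2 M maxM A evA r (suc s) 3r<ls = by-reads (⊆V? (readSet A τ) X)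
  where
  τ = falsifier M
  X = support M
  proofX = maxterm⇒support-isProof maxM
  3r<lXs : 3 * r < costOf unitCost X * suc s
  3r<lXs = subst (λ l → 3 * r < l * suc s) (sizeL≡costOf-support M) 3r<ls
  X≢∅ : ¬ (X ⊆V emptyV)
  X≢∅ X⊆∅ = n≮0 (subst (λ l → 3 * r < l * suc s) (⊆∅⇒costOf≡0 unitCost X⊆∅) 3r<lXs)
  by-reads : Dec (readSet A τ ⊆V X) → RatioExceeds f A r (suc s)
  by-reads (no read⊈X) =
    let i , read∋i , i∉X = ⊈V⇒witness read⊈X
    in reads-outside-proof⇒RatioExceeds {A = A} r s proofX read∋i i∉X
  by-reads (yes read⊆X) =
    let ρ , fρ≡¬fτ , X⊆readρ =
          adversary-readSet (evaluation⇒extensional {A = A} evA) proofX {A} evA read⊆X X≢∅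
        P , _ , proofP = evA ρ
        fρ : f ρ ≡ true
        fρ = trans fρ≡¬fτ (cong not (maxterm-falsifier maxM))
        P≤2 = subst (_≤ 2) (sizeL-literals↾ ρ P) (minterm≤2 _ (proof⇒minterm fρ proofP))
    in unitCost⇒RatioExceeds {A = A} {r = r} {suc s} proofP X⊆readρ
         (3r<ls∧p≤2⇒rp<sl r (costOf unitCost X) 3r<lXs P≤2)
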